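{- Let $(I_1,D_1)$ and $(I_2,D_2)$ be strongly tournament anti-Sidorenko pairs with $v(D_2)\ge|I_1|$. Let $D$ be a digraph formed by identifying $|I_1|$ vertices of $D_2$ with $I_1\subseteq V(D_1)$, i.e. $V(D)=V(D_1)\cup V(D_2)$ with $V(D_1)\cap V(D_2)=I_1$ and $E(D)=E(D_1)\sqcup E(D_2)$. Then $(I_2,D)$ is strongly tournament anti-Sidorenko.
   Context: All digraphs are oriented graphs (no loops, no antiparallel edges). A tournament is an orientation of a complete graph without loops. A labeled copy of a digraph $D$ in $T$ is an injective map $\varphi:V(D)\to V(T)$ with $(\varphi(x),\varphi(y))\in E(T)$ whenever $(x,y)\in E(D)$. For a digraph $D$ and an independent set $I\subseteq V(D)$, the pair $(I,D)$ is strongly tournament anti-Sidorenko if for every $n$, every $n$-vertex tournament $T$ and every injective map $\phi:I\to V(T)$, the number of labeled copies $\varphi$ of $D$ in $T$ with $\varphi|_I=\phi$ is at most $2^{ -e(D)}n^{v(D)-|I|}$. -}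

module Defs where

open import Data.Nat using (ℕ; zero; suc; _+_; _*_; _∸_; _^_; _≤_)
open import Data.Bool using (Bool; true; false; not; if_then_else_)
open import Data.Bool.Properties using () renaming (_≟_ to _≟B_)
open import Data.Fin using (Fin; zero; suc)
open import Data.Fin.Properties using (all?) renaming (_≟_ to _≟F_)
open import Data.List using (List; []; _∷_; map; concatMap; filter; length; allFin)
open import Data.Nat.ListAction using (sum)
open import Data.Product using (Σ; ∃; ∃-syntax; _×_; _,_)
open import Data.Sum using (_⊎_)
open import Relation.Binary.PropositionalEquality using (_≡_; _≢_)
open import Relation.Nullary using (Dec; ¬_)
open import Relation.Nullary.Decidable using (_→-dec_; _×-dec_)
open import Function using (_∘_)
open import Function.Bundles using (_⇔_)

Inj : ∀ {a b} → (Fin a → Fin b) → Set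
Inj f = ∀ x y → f x ≡ f y → x ≡ y

-- An oriented graph (digraph in the paper's sense) on vertex set Fin v,
-- given by a Boolean adjacency relation: no loops, no antiparallel edges.
record Digraph : Set where
  field
    v          : ℕ
    adj        : Fin v → Fin v → Bool
    loopless   : ∀ x → adj x x ≡ false
    oriented   : ∀ x y → adj x y ≡ true → adj y x ≡ false
open Digraph public

edges : (D : Digraph) → ℕ
edges D = sum (map (λ x → sum (map (λ y → if adj D x y then 1 else 0)
                                  (allFin (v D))))
                   (allFin (v D)))

record Tournament (n : ℕ) : Set where
  field
    tadj     : Fin n → Fin n → Bool
    irrefl   : ∀ x → tadj x x ≡ false
    complete : ∀ x y → x ≢ y → tadj x y ≡ not (tadj y x)
open Tournament public

-- An independent set I of D, given as an injection ι : Fin k → Fin (v D)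
-- (I = image of ι, |I| = k), with no edge of D inside I.
Independent : (D : Digraph) {k : ℕ} → (Fin k → Fin (v D)) → Set
Independent D ι = ∀ i j → adj D (ι i) (ι j) ≡ false

-- All functions Fin v → Fin n, each listed exactly once (up to pointwise equality)
cons : ∀ {v n} → Fin n → (Fin v → Fin n) → Fin (suc v) → Fin n
cons a f zero    = a
cons a f (suc i) = f i

allFuns : (v n : ℕ) → List (Fin v → Fin n)
allFuns zero    n = (λ ()) ∷ []
allFuns (suc v) n = concatMap (λ f → map (λ a → cons a f) (allFin n)) (allFuns v n)

IsCopy : (D : Digraph) {n : ℕ} (T : Tournament n) → (Fin (v D) → Fin n) → Set
IsCopy D T ψ = Inj ψ × (∀ x y → adj D x y ≡ true → tadj T (ψ x) (ψ y) ≡ true)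

IsCopyExt : (D : Digraph) {n k : ℕ} (T : Tournament n)
            (ι : Fin k → Fin (v D)) (φ : Fin k → Fin n) → (Fin (v D) → Fin n) → Set
IsCopyExt D T ι φ ψ = IsCopy D T ψ × (∀ i → ψ (ι i) ≡ φ i)

isCopyExt? : (D : Digraph) {n k : ℕ} (T : Tournament n)
             (ι : Fin k → Fin (v D)) (φ : Fin k → Fin n) → ∀ ψ → Dec (IsCopyExt D T ι φ ψ)
isCopyExt? D T ι φ ψ =
  ((all? λ x → all? λ y → (ψ x ≟F ψ y) →-dec (x ≟F y))
   ×-dec (all? λ x → all? λ y → (adj D x y ≟B true) →-dec (tadj T (ψ x) (ψ y) ≟B true)))
  ×-dec (all? λ i → ψ (ι i) ≟F φ i)

copies : (D : Digraph) {n k : ℕ} (T : Tournament n)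
         (ι : Fin k → Fin (v D)) (φ : Fin k → Fin n) → ℕ
copies D {n} T ι φ = length (filter (isCopyExt? D T ι φ) (allFuns (v D) n))

-- (I, D) is strongly tournament anti-Sidorenko; the bound
-- #copies ≤ 2^{-e(D)} n^{v(D)-|I|} is written multiplied out in ℕ.
StronglyTAS : (D : Digraph) {k : ℕ} → (Fin k → Fin (v D)) → Set
StronglyTAS D {k} ι =
  Inj ι × Independent D ι ×
  (∀ n (T : Tournament n) (φ : Fin k → Fin n) → Inj φ →
     copies D T ι φ * 2 ^ edges D ≤ n ^ (v D ∸ k))

-- D is obtained by gluing D₂ onto D₁ along I₁ (ι₁ : Fin k₁ → V(D₁)):
-- α₁, α₂ embed V(D₁), V(D₂) into V(D); they cover V(D); the images meet
-- exactly in α₁(I₁); and E(D) = α₁(E(D₁)) ∪ α₂(E(D₂)).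
record IsGluing (D₁ D₂ D : Digraph) {k₁ : ℕ} (ι₁ : Fin k₁ → Fin (v D₁))
                (α₁ : Fin (v D₁) → Fin (v D)) (α₂ : Fin (v D₂) → Fin (v D)) : Set where
  field
    inj₁   : Inj α₁
    inj₂   : Inj α₂
    cover  : ∀ z → (∃[ x ] α₁ x ≡ z) ⊎ (∃[ y ] α₂ y ≡ z)
    meet   : ∀ x y → α₁ x ≡ α₂ y → ∃[ i ] x ≡ ι₁ i
    glued  : ∀ i → ∃[ y ] α₁ (ι₁ i) ≡ α₂ y
    edgesD : ∀ a b → (adj D a b ≡ true) ⇔
               ((∃[ x ] ∃[ y ] α₁ x ≡ a × α₁ y ≡ b × adj D₁ x y ≡ true)
               ⊎ (∃[ x ] ∃[ y ] α₂ x ≡ a × α₂ y ≡ b × adj D₂ x y ≡ true))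

-- A copy ψ of D extending φ is determined by its restrictions ψ ∘ α₂ and ψ ∘ α₁. The first is
-- a copy of D₂ extending φ; the second is a copy of D₁ extending the values the first takes on
-- the glued vertices. Summing the bound for D₁ over the copies of D₂ and then applying the bound
-- for D₂ gives  #copies · 2^(e(D₁)+e(D₂)) ≤ n^((v(D₂)−|I₂|) + (v(D₁)−|I₁|)).  Since
-- e(D) ≤ e(D₁) + e(D₂) and v(D₁) + v(D₂) ≤ v(D) + |I₁|, this is at most n^(v(D)−|I₂|).
module Submission where

open import Defs
open import Data.Nat using (ℕ; zero; suc; _+_; _*_; _∸_; _^_; _≤_; _<_; z≤n; s≤s)
open import Data.Nat.Properties
open import Data.Nat.ListAction using (sum)
open import Data.Bool using (Bool; true; false; if_then_else_)
open import Data.Bool.Properties using (¬-not) renaming (_≟_ to _≟B_)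
open import Data.Fin using (Fin; zero; suc; splitAt; join)
open import Data.Fin.Properties using (any?; injective⇒≤; splitAt-join; join-splitAt) renaming (_≟_ to _≟F_)
open import Data.List using (List; []; _∷_; _++_; map; concatMap; filter; length; allFin)
open import Data.List.Properties using (length-++; length-map; length-removeAt′; map-cong)
open import Data.List.Relation.Unary.All as All using (All; []; _∷_)
import Data.List.Relation.Unary.All.Properties as All
open import Data.List.Relation.Unary.Any using (here; there; index; _─_)
open import Data.List.Relation.Unary.AllPairs as AllPairs using (AllPairs; []; _∷_)
import Data.List.Relation.Unary.AllPairs.Properties as AllPairs
open import Data.List.Relation.Unary.Unique.Propositional.Properties using (allFin⁺)
open import Data.List.Membership.Propositional using (_∈_; lose; find)
open import Data.List.Membership.Propositional.Properties
open import Data.Product using (∃; ∃-syntax; _×_; _,_; proj₁; proj₂)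
open import Data.Sum using (_⊎_; inj₁; inj₂)
import Data.Sum as Sum
open import Data.Empty using (⊥; ⊥-elim)
open import Relation.Binary.PropositionalEquality
open import Relation.Nullary using (¬_; yes; no)
open import Function using (_∘_; case_of_)
open import Function.Bundles using (Equivalence)
open import Algebra.Properties.CommutativeSemigroup *-commutativeSemigroup using (xy∙z≈xz∙y)
open import Data.Nat.Solver using (module +-*-Solver)
open +-*-Solver using (solve; _:+_; _:=_)

∈-─⁻ : ∀ {A : Set} {x y : A} {ys} (y∈ys : y ∈ ys) → x ∈ ys → x ≡ y ⊎ x ∈ (ys ─ y∈ys)
∈-─⁻ (here refl) (here refl) = inj₁ refl
∈-─⁻ (here refl) (there x∈ys) = inj₂ x∈ys
∈-─⁻ (there y∈ys) (here refl) = inj₂ (here refl)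
∈-─⁻ (there y∈ys) (there x∈ys) = Sum.map₂ there (∈-─⁻ y∈ys x∈ys)

length-≤-of-relation : ∀ {A B : Set} {_#_ : A → A → Set} (R : A → B → Set) {xs : List A} {ys : List B} →
                       AllPairs _#_ xs → (∀ {x x′ y} → R x y → R x′ y → ¬ x # x′) →
                       (∀ {x} → x ∈ xs → ∃[ y ] y ∈ ys × R x y) → length xs ≤ length ys
length-≤-of-relation R [] unique total = z≤n
length-≤-of-relation R {x ∷ xs} {ys} (x#xs ∷ xs#) unique total = step (total (here refl))
  where
  step : ∃[ y ] y ∈ ys × R x y → suc (length xs) ≤ length ys
  step (y , y∈ys , Rxy) = subst (suc (length xs) ≤_) (sym (length-removeAt′ ys (index y∈ys)))
                                (s≤s (length-≤-of-relation R xs# unique total′))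
    where
    total′ : ∀ {x′} → x′ ∈ xs → ∃[ y′ ] y′ ∈ (ys ─ y∈ys) × R x′ y′
    total′ x′∈xs with y′ , y′∈ys , Rx′y′ ← total (there x′∈xs) with ∈-─⁻ y∈ys y′∈ys
    ... | inj₁ refl = ⊥-elim (unique Rxy Rx′y′ (All.lookup x#xs x′∈xs))
    ... | inj₂ y′∈ys─y = y′ , y′∈ys─y , Rx′y′

⊎-≤-of-relation : ∀ {a b c d} (R : Fin a ⊎ Fin b → Fin c ⊎ Fin d → Set) →
                  (∀ x → ∃ (R x)) → (∀ {x x′ y} → R x y → R x′ y → x ≡ x′) → a + b ≤ c + d
⊎-≤-of-relation {a} {b} {c} {d} R total unique = injective⇒≤ code-injective
  where
  code : Fin (a + b) → Fin (c + d)
  code = join c d ∘ proj₁ ∘ total ∘ splitAt a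

  code-injective : ∀ {i j} → code i ≡ code j → i ≡ j
  code-injective {i} {j} eq = splitAt-injective (unique (proj₂ (total (splitAt a i))) Rj)
    where
    splitAt-injective : splitAt a i ≡ splitAt a j → i ≡ j
    splitAt-injective e = trans (sym (join-splitAt a b i)) (trans (cong (join a b) e) (join-splitAt a b j))
    Rj : R (splitAt a j) (proj₁ (total (splitAt a i)))
    Rj = subst (R (splitAt a j)) (trans (sym (splitAt-join c d _)) (trans (cong (splitAt c) (sym eq)) (splitAt-join c d _)))
               (proj₂ (total (splitAt a j)))

module _ {A B : Set} where

  length-concatMap : (f : A → List B) (xs : List A) → length (concatMap f xs) ≡ sum (map (length ∘ f) xs)
  length-concatMap f [] = refl
  length-concatMap f (x ∷ xs) = trans (length-++ (f x)) (cong (length (f x) +_) (length-concatMap f xs))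

  AllPairs-concatMap⁺ : ∀ {R : A → A → Set} {S : B → B → Set} (f : A → List B) {xs} → AllPairs R xs →
                        (∀ a → AllPairs S (f a)) → (∀ {a a′ b b′} → R a a′ → b ∈ f a → b′ ∈ f a′ → S b b′) →
                        AllPairs S (concatMap f xs)
  AllPairs-concatMap⁺ f {xs} R-xs S-within S-across =
    AllPairs.concat⁺ (All.map⁺ (All.universal S-within xs))
                     (AllPairs.map⁺ (AllPairs.map (λ r → All.tabulate λ b∈ → All.tabulate λ b′∈ → S-across r b∈ b′∈) R-xs))

sum-map-*-≤ : ∀ {A : Set} (g : A → ℕ) {c m} (xs : List A) → All (λ x → g x * c ≤ m) xs →
              sum (map g xs) * c ≤ length xs * m
sum-map-*-≤ g [] [] = z≤n
sum-map-*-≤ g {c} {m} (x ∷ xs) (gx≤ ∷ gxs≤) =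
  subst (_≤ m + length xs * m) (sym (*-distribʳ-+ c (g x) (sum (map g xs)))) (+-mono-≤ gx≤ (sum-map-*-≤ g xs gxs≤))

length-filter-≡ᵇ-true : ∀ {A : Set} (b : A → Bool) (xs : List A) →
                        length (filter (λ x → b x ≟B true) xs) ≡ sum (map (λ x → if b x then 1 else 0) xs)
length-filter-≡ᵇ-true b [] = refl
length-filter-≡ᵇ-true b (x ∷ xs) with b x
... | true = cong suc (length-filter-≡ᵇ-true b xs)
... | false = length-filter-≡ᵇ-true b xs

allFuns-complete : ∀ m n (g : Fin m → Fin n) → ∃[ g′ ] g′ ∈ allFuns m n × g ≗ g′
allFuns-complete zero n g = (λ ()) , here refl , λ ()
allFuns-complete (suc m) n g with f , f∈ , g∘suc≗f ← allFuns-complete m n (g ∘ suc) =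
  cons (g zero) f ,
  ∈-concatMap⁺ _ (lose f∈ (∈-map⁺ (λ a → cons a f) (∈-allFin (g zero)))) ,
  λ { zero → refl ; (suc i) → g∘suc≗f i }

allFuns-distinct : ∀ m n → AllPairs (λ f g → ¬ f ≗ g) (allFuns m n)
allFuns-distinct zero n = [] ∷ []
allFuns-distinct (suc m) n = AllPairs-concatMap⁺ _ (allFuns-distinct m n) heads-distinct tails-distinct
  where
  heads-distinct : ∀ f → AllPairs (λ f g → ¬ f ≗ g) (map (λ a → cons a f) (allFin n))
  heads-distinct f = AllPairs.map⁺ (AllPairs.map (λ a≢a′ eq → a≢a′ (eq zero)) (allFin⁺ n))
  tails-distinct : ∀ {f f′ : Fin m → Fin n} {g g′} → ¬ f ≗ f′ →
                   g ∈ map (λ a → cons a f) (allFin n) → g′ ∈ map (λ a → cons a f′) (allFin n) → ¬ g ≗ g′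
  tails-distinct f≉f′ g∈ g′∈ g≗g′ with ∈-map⁻ _ g∈ | ∈-map⁻ _ g′∈
  ... | _ , _ , refl | _ , _ , refl = f≉f′ (g≗g′ ∘ suc)

allFuns-into-Fin0 : ∀ m → 0 < m → allFuns m 0 ≡ []
allFuns-into-Fin0 (suc m) _ = go (allFuns m 0)
  where
  go : ∀ (fs : List (Fin m → Fin 0)) → concatMap (λ f → map (λ a → cons a f) (allFin 0)) fs ≡ []
  go [] = refl
  go (_ ∷ fs) = go fs

module _ (X : Digraph) where

  outNeighbours : Fin (v X) → List (Fin (v X))
  outNeighbours x = filter (λ y → adj X x y ≟B true) (allFin (v X))

  edgeList : List (Fin (v X) × Fin (v X))
  edgeList = concatMap (λ x → map (x ,_) (outNeighbours x)) (allFin (v X))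

  edges≡length-edgeList : edges X ≡ length edgeList
  edges≡length-edgeList = sym (begin
    length edgeList                                               ≡⟨ length-concatMap _ (allFin (v X)) ⟩
    sum (map (λ x → length (map (x ,_) (outNeighbours x))) (allFin (v X)))
      ≡⟨ cong sum (map-cong (λ x → trans (length-map _ (outNeighbours x)) (length-filter-≡ᵇ-true (adj X x) (allFin (v X)))) (allFin (v X))) ⟩
    edges X                                                       ∎)
    where open ≡-Reasoning

  edgeList-distinct : AllPairs _≢_ edgeList
  edgeList-distinct = AllPairs-concatMap⁺ _ (allFin⁺ (v X)) targets-distinct sources-distinct
    where
    targets-distinct : ∀ x → AllPairs _≢_ (map (x ,_) (outNeighbours x))
    targets-distinct x = AllPairs.map⁺ (AllPairs.map (λ y≢y′ eq → y≢y′ (cong proj₂ eq)) (AllPairs.filter⁺ _ (allFin⁺ (v X))))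
    sources-distinct : ∀ {x x′ e e′} → x ≢ x′ → e ∈ map (x ,_) (outNeighbours x) → e′ ∈ map (x′ ,_) (outNeighbours x′) → e ≢ e′
    sources-distinct x≢x′ e∈ e′∈ with ∈-map⁻ _ e∈ | ∈-map⁻ _ e′∈
    ... | _ , _ , refl | _ , _ , refl = x≢x′ ∘ cong proj₁

  ∈-edgeList⁺ : ∀ {x y} → adj X x y ≡ true → (x , y) ∈ edgeList
  ∈-edgeList⁺ {x} {y} xy = ∈-concatMap⁺ _ (lose (∈-allFin x) (∈-map⁺ (x ,_) (∈-filter⁺ _ (∈-allFin y) xy)))

  ∈-edgeList⁻ : ∀ {x y} → (x , y) ∈ edgeList → adj X x y ≡ true
  ∈-edgeList⁻ e∈ with x , _ , e∈out ← find (∈-concatMap⁻ _ {xs = allFin (v X)} e∈)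
                 with y , y∈ , refl ← ∈-map⁻ _ e∈out =
    proj₂ (∈-filter⁻ (λ y → adj X x y ≟B true) {xs = allFin (v X)} y∈)

copyList : (D : Digraph) {n k : ℕ} (T : Tournament n) (ι : Fin k → Fin (v D)) (φ : Fin k → Fin n) →
           List (Fin (v D) → Fin n)
copyList D {n} T ι φ = filter (isCopyExt? D T ι φ) (allFuns (v D) n)

module _ (D : Digraph) {n k : ℕ} (T : Tournament n) (ι : Fin k → Fin (v D)) where

  IsCopyExt-resp : ∀ {φ φ′ ψ ψ′} → ψ ≗ ψ′ → φ ≗ φ′ → IsCopyExt D T ι φ ψ → IsCopyExt D T ι φ′ ψ′
  IsCopyExt-resp ψ≗ψ′ φ≗φ′ ((ψ-inj , ψ-hom) , ψ-ext) =
    ((λ x y eq → ψ-inj x y (trans (ψ≗ψ′ x) (trans eq (sym (ψ≗ψ′ y))))) ,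
     (λ x y xy → subst₂ (λ a b → tadj T a b ≡ true) (ψ≗ψ′ x) (ψ≗ψ′ y) (ψ-hom x y xy))) ,
    λ i → trans (sym (ψ≗ψ′ (ι i))) (trans (ψ-ext i) (φ≗φ′ i))

  ∈-copyList⁺ : ∀ {φ ψ} → IsCopyExt D T ι φ ψ → ∃[ ψ′ ] ψ′ ∈ copyList D T ι φ × ψ ≗ ψ′
  ∈-copyList⁺ {φ} {ψ} copy with ψ′ , ψ′∈ , ψ≗ψ′ ← allFuns-complete (v D) n ψ =
    ψ′ , ∈-filter⁺ (isCopyExt? D T ι φ) ψ′∈ (IsCopyExt-resp ψ≗ψ′ (λ _ → refl) copy) , ψ≗ψ′

  ∈-copyList⁻ : ∀ {φ ψ} → ψ ∈ copyList D T ι φ → IsCopyExt D T ι φ ψ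
  ∈-copyList⁻ {φ} ψ∈ = proj₂ (∈-filter⁻ (isCopyExt? D T ι φ) {xs = allFuns (v D) n} ψ∈)

  copyList-distinct : ∀ φ → AllPairs (λ ψ ψ′ → ¬ ψ ≗ ψ′) (copyList D T ι φ)
  copyList-distinct φ = AllPairs.filter⁺ (isCopyExt? D T ι φ) (allFuns-distinct (v D) n)

copies-into-Fin0 : ∀ (D : Digraph) {k} (T : Tournament 0) (ι : Fin k → Fin (v D)) φ → 0 < v D → copies D T ι φ ≡ 0
copies-into-Fin0 D T ι φ 0<v = cong (length ∘ filter (isCopyExt? D T ι φ)) (allFuns-into-Fin0 (v D) 0<v)

IsCopy-∘ : ∀ (D′ D : Digraph) {n} (T : Tournament n) {α : Fin (v D′) → Fin (v D)} →
           Inj α → (∀ x y → adj D′ x y ≡ true → adj D (α x) (α y) ≡ true) →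
           ∀ {ψ} → IsCopy D T ψ → IsCopy D′ T (ψ ∘ α)
IsCopy-∘ D′ D T α-inj α-hom (ψ-inj , ψ-hom) =
  (λ x y eq → α-inj x y (ψ-inj _ _ eq)) , λ x y xy → ψ-hom _ _ (α-hom x y xy)

module Gluing {D₁ D₂ D : Digraph} {k₁ : ℕ} {ι₁ : Fin k₁ → Fin (v D₁)}
              {α₁ : Fin (v D₁) → Fin (v D)} {α₂ : Fin (v D₂) → Fin (v D)}
              (G : IsGluing D₁ D₂ D ι₁ α₁ α₂) where

  open IsGluing G renaming (inj₁ to α₁-injective; inj₂ to α₂-injective)

  shared : Fin k₁ → Fin (v D₂)
  shared i = proj₁ (glued i)

  shared-injective : Inj ι₁ → Inj shared
  shared-injective ι₁-inj i j eq =
    ι₁-inj i j (α₁-injective _ _ (trans (proj₂ (glued i)) (trans (cong α₂ eq) (sym (proj₂ (glued j))))))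

  edge⁺₁ : ∀ x y → adj D₁ x y ≡ true → adj D (α₁ x) (α₁ y) ≡ true
  edge⁺₁ x y xy = Equivalence.from (edgesD _ _) (inj₁ (x , y , refl , refl , xy))

  edge⁺₂ : ∀ x y → adj D₂ x y ≡ true → adj D (α₂ x) (α₂ y) ≡ true
  edge⁺₂ x y xy = Equivalence.from (edgesD _ _) (inj₂ (x , y , refl , refl , xy))

  edge⁻ : ∀ {a b} → adj D a b ≡ true →
          (∃[ x ] ∃[ y ] α₁ x ≡ a × α₁ y ≡ b × adj D₁ x y ≡ true) ⊎
          (∃[ x ] ∃[ y ] α₂ x ≡ a × α₂ y ≡ b × adj D₂ x y ≡ true)
  edge⁻ {a} {b} = Equivalence.to (edgesD a b)

  independent : ∀ {k₂} {ι₂ : Fin k₂ → Fin (v D₂)} →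
                Independent D₁ ι₁ → Independent D₂ ι₂ → Independent D (α₂ ∘ ι₂)
  independent {ι₂ = ι₂} ind₁ ind₂ i j = ¬-not no-edge
    where
    no-edge : adj D (α₂ (ι₂ i)) (α₂ (ι₂ j)) ≢ true
    no-edge e with edge⁻ e
    ... | inj₁ (x , y , x↦ , y↦ , xy) with i′ , refl ← meet x _ x↦ | j′ , refl ← meet y _ y↦ =
      case trans (sym xy) (ind₁ i′ j′) of λ ()
    ... | inj₂ (x , y , x↦ , y↦ , xy) with refl ← α₂-injective _ _ x↦ | refl ← α₂-injective _ _ y↦ =
      case trans (sym xy) (ind₂ i j) of λ ()

  Glued : Fin (v D₂) → Set
  Glued y = ∃[ i ] α₂ y ≡ α₁ (ι₁ i)

  -- A glued vertex of D₂ is recorded by its label in I₁ rather than by its image in D.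
  VertexCode : Fin (v D₁) ⊎ Fin (v D₂) → Fin (v D) ⊎ Fin k₁ → Set
  VertexCode (inj₁ x) (inj₁ z) = α₁ x ≡ z
  VertexCode (inj₁ x) (inj₂ i) = ⊥
  VertexCode (inj₂ y) (inj₁ z) = α₂ y ≡ z × ¬ Glued y
  VertexCode (inj₂ y) (inj₂ i) = α₂ y ≡ α₁ (ι₁ i)

  vertexCode-total : ∀ p → ∃ (VertexCode p)
  vertexCode-total (inj₁ x) = inj₁ (α₁ x) , refl
  vertexCode-total (inj₂ y) with any? (λ i → α₂ y ≟F α₁ (ι₁ i))
  ... | yes (i , y↦) = inj₂ i , y↦
  ... | no ¬glued = inj₁ (α₂ y) , refl , ¬glued

  vertexCode-unique : ∀ {p p′ c} → VertexCode p c → VertexCode p′ c → p ≡ p′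
  vertexCode-unique {inj₁ x} {inj₁ x′} {inj₁ _} refl eq = cong inj₁ (α₁-injective x x′ (sym eq))
  vertexCode-unique {inj₁ x} {inj₂ y} {inj₁ _} refl (eq , ¬glued) with i , refl ← meet x y (sym eq) =
    ⊥-elim (¬glued (i , eq))
  vertexCode-unique {inj₂ y} {inj₁ x} {inj₁ _} (refl , ¬glued) eq with i , refl ← meet x y eq =
    ⊥-elim (¬glued (i , sym eq))
  vertexCode-unique {inj₂ y} {inj₂ y′} {inj₁ _} (refl , _) (eq , _) = cong inj₂ (α₂-injective y y′ (sym eq))
  vertexCode-unique {inj₂ y} {inj₂ y′} {inj₂ _} eq eq′ = cong inj₂ (α₂-injective y y′ (trans eq (sym eq′)))

  vertex-count : v D₁ + v D₂ ≤ v D + k₁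
  vertex-count = ⊎-≤-of-relation VertexCode vertexCode-total vertexCode-unique

  EdgeOrigin : Fin (v D) × Fin (v D) → (Fin (v D₁) × Fin (v D₁)) ⊎ (Fin (v D₂) × Fin (v D₂)) → Set
  EdgeOrigin (a , b) (inj₁ (x , y)) = α₁ x ≡ a × α₁ y ≡ b
  EdgeOrigin (a , b) (inj₂ (x , y)) = α₂ x ≡ a × α₂ y ≡ b

  edge-count : edges D ≤ edges D₁ + edges D₂
  edge-count = begin
    edges D                                                       ≡⟨ edges≡length-edgeList D ⟩
    length (edgeList D)                                           ≤⟨ length-≤-of-relation EdgeOrigin (edgeList-distinct D) unique origin ⟩
    length (map inj₁ (edgeList D₁) ++ map inj₂ (edgeList D₂))     ≡⟨ length-++ (map inj₁ (edgeList D₁)) ⟩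
    length (map inj₁ (edgeList D₁)) + length (map inj₂ (edgeList D₂))
      ≡⟨ cong₂ _+_ (trans (length-map inj₁ (edgeList D₁)) (sym (edges≡length-edgeList D₁)))
                   (trans (length-map inj₂ (edgeList D₂)) (sym (edges≡length-edgeList D₂))) ⟩
    edges D₁ + edges D₂                                           ∎
    where
    open ≤-Reasoning
    unique : ∀ {e e′ o} → EdgeOrigin e o → EdgeOrigin e′ o → ¬ e ≢ e′
    unique {o = inj₁ _} (refl , refl) (refl , refl) e≢e′ = e≢e′ refl
    unique {o = inj₂ _} (refl , refl) (refl , refl) e≢e′ = e≢e′ refl
    origin : ∀ {e} → e ∈ edgeList D → ∃[ o ] o ∈ map inj₁ (edgeList D₁) ++ map inj₂ (edgeList D₂) × EdgeOrigin e o
    origin e∈ with edge⁻ (∈-edgeList⁻ D e∈)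
    ... | inj₁ (x , y , x↦ , y↦ , xy) = inj₁ (x , y) , ∈-++⁺ˡ (∈-map⁺ inj₁ (∈-edgeList⁺ D₁ xy)) , x↦ , y↦
    ... | inj₂ (x , y , x↦ , y↦ , xy) = inj₂ (x , y) , ∈-++⁺ʳ _ (∈-map⁺ inj₂ (∈-edgeList⁺ D₂ xy)) , x↦ , y↦

  restrictions-determine : ∀ {n} {ψ ψ′ : Fin (v D) → Fin n} → ψ ∘ α₁ ≗ ψ′ ∘ α₁ → ψ ∘ α₂ ≗ ψ′ ∘ α₂ → ψ ≗ ψ′
  restrictions-determine on₁ on₂ z with cover z
  ... | inj₁ (x , refl) = on₁ x
  ... | inj₂ (y , refl) = on₂ y

  module _ {n k₂ : ℕ} (T : Tournament n) (ι₂ : Fin k₂ → Fin (v D₂)) (φ : Fin k₂ → Fin n) where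

    copyPairs : List ((Fin (v D₂) → Fin n) × (Fin (v D₁) → Fin n))
    copyPairs = concatMap (λ g → map (g ,_) (copyList D₁ T ι₁ (g ∘ shared))) (copyList D₂ T ι₂ φ)

    Restricts : (Fin (v D) → Fin n) → (Fin (v D₂) → Fin n) × (Fin (v D₁) → Fin n) → Set
    Restricts ψ (g , h) = ψ ∘ α₂ ≗ g × ψ ∘ α₁ ≗ h

    restrictions : ∀ {ψ} → ψ ∈ copyList D T (α₂ ∘ ι₂) φ → ∃[ gh ] gh ∈ copyPairs × Restricts ψ gh
    restrictions {ψ} ψ∈ with ψ-copy , ψ-ext ← ∈-copyList⁻ D T (α₂ ∘ ι₂) ψ∈
      with g , g∈ , ψα₂≗g ← ∈-copyList⁺ D₂ T ι₂ (IsCopy-∘ D₂ D T α₂-injective edge⁺₂ ψ-copy , ψ-ext)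
      with h , h∈ , ψα₁≗h ← ∈-copyList⁺ D₁ T ι₁
             (IsCopyExt-resp D₁ T ι₁ (λ _ → refl) (ψα₂≗g ∘ shared)
               (IsCopy-∘ D₁ D T α₁-injective edge⁺₁ ψ-copy , λ i → cong ψ (proj₂ (glued i)))) =
      (g , h) , ∈-concatMap⁺ _ (lose g∈ (∈-map⁺ (g ,_) h∈)) , ψα₂≗g , ψα₁≗h

    copies-≤-sum : copies D T (α₂ ∘ ι₂) φ ≤ sum (map (λ g → copies D₁ T ι₁ (g ∘ shared)) (copyList D₂ T ι₂ φ))
    copies-≤-sum = begin
      copies D T (α₂ ∘ ι₂) φ ≤⟨ length-≤-of-relation Restricts (copyList-distinct D T (α₂ ∘ ι₂) φ) unique restrictions ⟩
      length copyPairs       ≡⟨ length-concatMap _ (copyList D₂ T ι₂ φ) ⟩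
      sum (map (λ g → length (map (g ,_) (copyList D₁ T ι₁ (g ∘ shared)))) (copyList D₂ T ι₂ φ))
        ≡⟨ cong sum (map-cong (λ g → length-map (g ,_) (copyList D₁ T ι₁ (g ∘ shared))) (copyList D₂ T ι₂ φ)) ⟩
      sum (map (λ g → copies D₁ T ι₁ (g ∘ shared)) (copyList D₂ T ι₂ φ)) ∎
      where
      open ≤-Reasoning
      unique : ∀ {ψ ψ′ gh} → Restricts ψ gh → Restricts ψ′ gh → ¬ ¬ ψ ≗ ψ′
      unique (ψα₂≗g , ψα₁≗h) (ψ′α₂≗g , ψ′α₁≗h) ψ≉ψ′ =
        ψ≉ψ′ (restrictions-determine (λ x → trans (ψα₁≗h x) (sym (ψ′α₁≗h x)))
                                     (λ y → trans (ψα₂≗g y) (sym (ψ′α₂≗g y))))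

  copies-bound : ∀ {k₂} {ι₂ : Fin k₂ → Fin (v D₂)} → StronglyTAS D₁ ι₁ → StronglyTAS D₂ ι₂ →
                 ∀ n (T : Tournament n) φ → Inj φ →
                 copies D T (α₂ ∘ ι₂) φ * 2 ^ edges D ≤ n ^ ((v D₂ ∸ k₂) + (v D₁ ∸ k₁))
  copies-bound {k₂} {ι₂} (ι₁-inj , _ , bound₁) (_ , _ , bound₂) n T φ φ-inj = begin
    copies D T (α₂ ∘ ι₂) φ * 2 ^ edges D  ≤⟨ *-mono-≤ (copies-≤-sum T ι₂ φ) (^-monoʳ-≤ 2 edge-count) ⟩
    S * 2 ^ (e₁ + e₂)                     ≡⟨ cong (S *_) (^-distribˡ-+-* 2 e₁ e₂) ⟩
    S * (2 ^ e₁ * 2 ^ e₂)                 ≡⟨ *-assoc S _ _ ⟨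
    S * 2 ^ e₁ * 2 ^ e₂                   ≤⟨ *-monoˡ-≤ (2 ^ e₂) (sum-map-*-≤ c₁ (copyList D₂ T ι₂ φ) each) ⟩
    c₂ * N₁ * 2 ^ e₂                      ≡⟨ xy∙z≈xz∙y c₂ N₁ (2 ^ e₂) ⟩
    c₂ * 2 ^ e₂ * N₁                      ≤⟨ *-monoˡ-≤ N₁ (bound₂ n T φ φ-inj) ⟩
    n ^ (v D₂ ∸ k₂) * N₁                  ≡⟨ ^-distribˡ-+-* n (v D₂ ∸ k₂) (v D₁ ∸ k₁) ⟨
    n ^ ((v D₂ ∸ k₂) + (v D₁ ∸ k₁))       ∎
    where
    open ≤-Reasoning
    e₁ = edges D₁
    e₂ = edges D₂
    N₁ = n ^ (v D₁ ∸ k₁)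
    c₂ = copies D₂ T ι₂ φ
    c₁ : (Fin (v D₂) → Fin n) → ℕ
    c₁ g = copies D₁ T ι₁ (g ∘ shared)
    S = sum (map c₁ (copyList D₂ T ι₂ φ))
    each : All (λ g → c₁ g * 2 ^ e₁ ≤ N₁) (copyList D₂ T ι₂ φ)
    each = All.tabulate λ g∈ →
      bound₁ n T _ λ i j → shared-injective ι₁-inj i j ∘ proj₁ (proj₁ (∈-copyList⁻ D₂ T ι₂ g∈)) _ _

exponent-bound : ∀ {v v₁ v₂ k₁ k₂} → v₁ + v₂ ≤ v + k₁ → k₁ ≤ v₁ → k₂ ≤ v₂ → (v₂ ∸ k₂) + (v₁ ∸ k₁) ≤ v ∸ k₂
exponent-bound {v} {v₁} {v₂} {k₁} {k₂} vertices k₁≤v₁ k₂≤v₂ =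
  m+n≤o⇒m≤o∸n ((v₂ ∸ k₂) + (v₁ ∸ k₁)) (+-cancelʳ-≤ k₁ _ _ (subst (_≤ v + k₁) regroup vertices))
  where
  regroup : v₁ + v₂ ≡ (v₂ ∸ k₂) + (v₁ ∸ k₁) + k₂ + k₁
  regroup = begin
    v₁ + v₂                                ≡⟨ cong₂ _+_ (m∸n+n≡m k₁≤v₁) (m∸n+n≡m k₂≤v₂) ⟨
    (v₁ ∸ k₁) + k₁ + ((v₂ ∸ k₂) + k₂)      ≡⟨ solve 4 (λ a b c d → (a :+ c) :+ (b :+ d) := (b :+ a :+ d) :+ c)
                                                     refl (v₁ ∸ k₁) (v₂ ∸ k₂) k₁ k₂ ⟩
    (v₂ ∸ k₂) + (v₁ ∸ k₁) + k₂ + k₁        ∎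
    where open ≡-Reasoning

-- For n = 0 the power n ^ b is not monotone in b, so the count itself must vanish.
≤-^-weakenʳ : ∀ {x} n {a b} → x ≤ n ^ a → a ≤ b → (n ≡ 0 → 0 < b → x ≡ 0) → x ≤ n ^ b
≤-^-weakenʳ (suc n) x≤ a≤b _ = ≤-trans x≤ (^-monoʳ-≤ (suc n) a≤b)
≤-^-weakenʳ zero {b = zero} x≤ z≤n _ = x≤
≤-^-weakenʳ zero {b = suc b} _ _ vanish = ≤-reflexive (vanish refl (s≤s z≤n))

lemma3p10 : (D₁ D₂ D : Digraph) {k₁ k₂ : ℕ}
            (ι₁ : Fin k₁ → Fin (v D₁)) (ι₂ : Fin k₂ → Fin (v D₂)) →
            StronglyTAS D₁ ι₁ → StronglyTAS D₂ ι₂ → k₁ ≤ v D₂ →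
            (α₁ : Fin (v D₁) → Fin (v D)) (α₂ : Fin (v D₂) → Fin (v D)) →
            IsGluing D₁ D₂ D ι₁ α₁ α₂ →
            StronglyTAS D (α₂ ∘ ι₂)
lemma3p10 D₁ D₂ D {k₂ = k₂} ι₁ ι₂ tas₁@(ι₁-inj , ind₁ , _) tas₂@(ι₂-inj , ind₂ , _) _ α₁ α₂ G =
  (λ i j → ι₂-inj i j ∘ IsGluing.inj₂ G _ _) , independent ind₁ ind₂ , bound
  where
  open Gluing G
  bound : ∀ n (T : Tournament n) φ → Inj φ → copies D T (α₂ ∘ ι₂) φ * 2 ^ edges D ≤ n ^ (v D ∸ k₂)
  bound n T φ φ-inj =
    ≤-^-weakenʳ n (copies-bound tas₁ tas₂ n T φ φ-inj)
      (exponent-bound vertex-count (injective⇒≤ (ι₁-inj _ _)) (injective⇒≤ (ι₂-inj _ _)))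
      λ { refl 0<v∸k₂ → cong (_* 2 ^ edges D)
                             (copies-into-Fin0 D T (α₂ ∘ ι₂) φ (<-≤-trans 0<v∸k₂ (m∸n≤m (v D) k₂))) }
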